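{- Let $E$ be a $\mathbb{Z}$-linear combination of terms of the form $\alpha(x)^i x^j$ ($i,j \geq 0$ integers) in a single variable $x$ and a single formal function $\alpha$, such that at least one term with $i > 0$ appears (with non-zero coefficient after collecting like terms). Then for every $\epsilon > 0$ and every $M$ there exist a modulus $q$, which is a product of distinct primes all larger than $M$, and a map $\alpha : \mathbb{Z}_q \to \mathbb{Z}_q$ such that, with this $\alpha$ substituted, $E$ takes at most $\epsilon q$ values in $\mathbb{Z}_q$ as $x$ ranges over $\mathbb{Z}_q$. -}

module Defs where

open import Data.Nat as ℕ using (ℕ; zero; suc)
open import Data.Integer as ℤ using (ℤ; +_; _%ℕ_)
open import Data.Fin using (Fin; toℕ)
open import Data.List using (List; []; _∷_; length; filter)
open import Data.Nat.ListAction using (product)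
open import Data.List.Relation.Unary.Any using (any?)
open import Data.List.Relation.Unary.All using (All)
open import Data.List.Relation.Unary.Unique.Propositional using (Unique)
open import Data.List.Membership.Propositional using (_∈_)
open import Data.Fin using (Fin)
open import Data.Product using (_×_; Σ; ∃; ∃-syntax)
open import Data.Nat.Primality using (Prime)
open import Data.List using (allFin)
open import Relation.Binary.PropositionalEquality using (_≡_)

-- A Z-linear combination E = Σ_{i<d, j<e} c i j · α(x)^i · x^j,
-- given by its (already collected) coefficient table c.
Expr : ℕ → ℕ → Set
Expr d e = Fin d → Fin e → ℤ

∑ : (n : ℕ) → (Fin n → ℤ) → ℤ
∑ zero    f = + 0
∑ (suc n) f = f Data.Fin.zero ℤ.+ ∑ n (λ i → f (Data.Fin.suc i))

evalℤ : ∀ {d e} → Expr d e → ℤ → ℤ → ℤ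
evalℤ {d} {e} c a x = ∑ d (λ i → ∑ e (λ j → c i j ℤ.* (a ℤ.^ toℕ i) ℤ.* (x ℤ.^ toℕ j)))

reduce : ℕ → ℤ → ℕ
reduce zero    z = ℤ.∣ z ∣
reduce (suc k) z = z %ℕ suc k

evalMod : ∀ {d e} → Expr d e → (q : ℕ) → (Fin q → Fin q) → Fin q → ℕ
evalMod c q α x = reduce q (evalℤ c (+ toℕ (α x)) (+ toℕ x))

numValues : ∀ {d e} → Expr d e → (q : ℕ) → (Fin q → Fin q) → ℕ
numValues c q α =
  length (filter (λ y → any? (λ x → evalMod c q α x ℕ.≟ toℕ y) (allFin q)) (allFin q))

SquarefreeAbove : ℕ → ℕ → Set
SquarefreeAbove M q =
  ∃[ ps ] (Unique ps × All (λ p → Prime p × M ℕ.< p) ps × q ≡ product ps)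

-- Fix a prime P > M not dividing a coefficient c i₀ j₀ with i₀ > 0, and read E mod P as a polynomial
-- in a = α(x) of degree at most D = d - 1 whose coefficients H i (x) are polynomials in x. By
-- Lagrange's theorem H i₀ vanishes at fewer than e residues x; at every other x the map a ↦ E(a, x)
-- is at most D-to-one, so some value is reached (for a suitable a) from at least a 1/D fraction of
-- the remaining points x. Choosing such values greedily covers all of them after D·s steps when
-- P < 2^s, because (1 - 1/D)^D ≤ 1/2. Letting α(x) be a witnessing a, and α(x) = x at the fewer than
-- e bad points, E takes at most D·s + e ≈ D log₂ P values, which is below εP once P is large.

module Submission where

open import Defs

module Polynomials where

  open import Data.Nat as ℕ using (ℕ; zero; suc; s≤s; _<_; _≤_; NonZero)
  import Data.Nat.Properties as ℕ
  open import Data.Nat.Divisibility as ℕ using (∣⇒≤)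
  open import Data.Nat.Primality using (Prime; euclidsLemma)
  open import Data.Integer as ℤ using (ℤ; +_; 0ℤ; _+_; _-_; _*_; _^_; _%ℕ_; _/ℕ_)
  import Data.Integer.Properties as ℤ
  open import Data.Integer.DivMod using (a≡a%ℕn+[a/ℕn]*n; n%ℕd<d)
  open import Data.Integer.Divisibility.Signed
    using (_∣_; divides; ∣ᵤ⇒∣; ∣⇒∣ᵤ; ∣m+n∣n⇒∣m; ∣n⇒∣m*n)
  open import Data.Integer.Tactic.RingSolver using (solve-∀)
  import Algebra.Properties.Semiring.Sum as SemiringSum
  open import Data.Fin using (Fin; toℕ; zero; suc)
  import Data.Fin.Properties as Fin
  open import Data.Vec.Functional using (Vector; head; tail; updateAt)
  open import Data.List using (List; _∷_; length)
  open import Data.List.Relation.Unary.All as All using (All; _∷_)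
  open import Data.List.Relation.Unary.Unique.Propositional using (Unique; _∷_)
  open import Data.Sum using (_⊎_; inj₁; inj₂; map)
  open import Data.Product using (_,_)
  open import Relation.Nullary using (contradiction)
  open import Relation.Binary.PropositionalEquality

  open SemiringSum ℤ.+-*-semiring using (sum; sum-cong-≗; *-distribˡ-sum; *-distribʳ-sum)

  prime∣*⇒∣⊎∣ : ∀ {p} → Prime p → ∀ i j → + p ∣ i * j → + p ∣ i ⊎ + p ∣ j
  prime∣*⇒∣⊎∣ p-prime i j p∣ij =
    map ∣ᵤ⇒∣ ∣ᵤ⇒∣ (euclidsLemma ℤ.∣ i ∣ ℤ.∣ j ∣ p-prime
      (subst (_ ℕ.∣_) (ℤ.abs-* i j) (∣⇒∣ᵤ p∣ij)))

  ∣∧<⇒≡0 : ∀ {m n} → m ℕ.∣ n → n < m → n ≡ 0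
  ∣∧<⇒≡0 {n = zero}  _   _   = refl
  ∣∧<⇒≡0 {n = suc _} m∣n n<m = contradiction (∣⇒≤ m∣n) (ℕ.<⇒≱ n<m)

  ∣-difference⇒≡ : ∀ {n} (a b : Fin n) → + n ∣ + toℕ a - + toℕ b → a ≡ b
  ∣-difference⇒≡ {n} a b n∣a-b =
    Fin.toℕ-injective (ℤ.+-injective (ℤ.i-j≡0⇒i≡j _ _ (ℤ.∣i∣≡0⇒i≡0 (∣∧<⇒≡0 (∣⇒∣ᵤ n∣a-b) ∣a-b∣<n))))
    where
    ∣a-b∣<n : ℤ.∣ + toℕ a - + toℕ b ∣ < n
    ∣a-b∣<n = begin-strict
      ℤ.∣ + toℕ a - + toℕ b ∣   ≡⟨ cong ℤ.∣_∣ (ℤ.[+m]-[+n]≡m⊖n (toℕ a) (toℕ b)) ⟩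
      ℤ.∣ toℕ a ℤ.⊖ toℕ b ∣     ≤⟨ ℤ.∣m⊝n∣≤m⊔n (toℕ a) (toℕ b) ⟩
      toℕ a ℕ.⊔ toℕ b           <⟨ ℕ.⊔-lub (Fin.toℕ<n a) (Fin.toℕ<n b) ⟩
      n                         ∎
      where open ℕ.≤-Reasoning

  ∣-reduce : ∀ q .{{_ : NonZero q}} z → + q ∣ z - + reduce q z
  ∣-reduce (suc n) z = divides (z /ℕ suc n) (begin
    z - + r                             ≡⟨ cong (_- + r) (a≡a%ℕn+[a/ℕn]*n z (suc n)) ⟩
    (+ r + z /ℕ suc n * + suc n) - + r  ≡⟨ cancel (+ r) (z /ℕ suc n * + suc n) ⟩
    z /ℕ suc n * + suc n                ∎)
    where
    open ≡-Reasoning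
    r = z %ℕ suc n
    cancel : ∀ a b → (a + b) - a ≡ b
    cancel = solve-∀

  reduce< : ∀ q .{{_ : NonZero q}} z → reduce q z < q
  reduce< (suc n) z = n%ℕd<d z (suc n)

  horner : ∀ {n} → Vector ℤ n → ℤ → ℤ
  horner {zero}  f x = 0ℤ
  horner {suc n} f x = head f + x * horner (tail f) x

  syntheticDivision : ∀ {n} → ℤ → Vector ℤ (suc n) → Vector ℤ n
  syntheticDivision r f zero    = horner (tail f) r
  syntheticDivision r f (suc i) = syntheticDivision r (tail f) i

  factor-theorem : ∀ {n} r (f : Vector ℤ (suc n)) x →
    horner f x ≡ (x - r) * horner (syntheticDivision r f) x + horner f r
  factor-theorem {zero} r f x = constant (head f) x r
    where
    constant : ∀ a x r → a + x * 0ℤ ≡ (x - r) * 0ℤ + (a + r * 0ℤ)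
    constant = solve-∀
  factor-theorem {suc n} r f x = begin
    head f + x * horner (tail f) x                        ≡⟨ cong (λ y → head f + x * y) (factor-theorem r (tail f) x) ⟩
    head f + x * ((x - r) * Q + horner (tail f) r)        ≡⟨ regroup (head f) x r Q (horner (tail f) r) ⟩
    (x - r) * (horner (tail f) r + x * Q) + horner f r    ∎
    where
    open ≡-Reasoning
    Q = horner (syntheticDivision r (tail f)) x
    regroup : ∀ a x r Q t → a + x * ((x - r) * Q + t) ≡ (x - r) * (t + x * Q) + (a + r * t)
    regroup = solve-∀

  horner-updateAt-zero : ∀ {n} (f : Vector ℤ (suc n)) v x → horner (updateAt f zero (_- v)) x ≡ horner f x - v
  horner-updateAt-zero f v x = shift (head f) v (x * horner (tail f) x)
    where
    shift : ∀ a v y → (a - v) + y ≡ (a + y) - v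
    shift = solve-∀

  ∣-coefficients : ∀ {m n} r (f : Vector ℤ (suc n)) → m ∣ horner f r →
    (∀ i → m ∣ syntheticDivision r f i) → ∀ i → m ∣ f i
  ∣-coefficients {n = zero} r f m∣f[r] _ zero =
    subst (_ ∣_) (trans (cong (λ y → head f + y) (ℤ.*-zeroʳ r)) (ℤ.+-identityʳ (head f))) m∣f[r]
  ∣-coefficients {n = suc n} r f m∣f[r] m∣q zero    = ∣m+n∣n⇒∣m m∣f[r] (∣n⇒∣m*n r (m∣q zero))
  ∣-coefficients {n = suc n} r f m∣f[r] m∣q (suc i) = ∣-coefficients r (tail f) (m∣q zero) (λ i → m∣q (suc i)) i

  Root : ∀ {n p} → Vector ℤ n → Fin p → Set
  Root {p = p} f r = + p ∣ horner f (+ toℕ r)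

  module _ {p : ℕ} (p-prime : Prime p) where

    root-of-quotient : ∀ {n} {r s : Fin p} (f : Vector ℤ (suc n)) → r ≢ s → Root f r → Root f s →
      Root (syntheticDivision (+ toℕ r) f) s
    root-of-quotient {r = r} {s} f r≢s f[r] f[s]
      with prime∣*⇒∣⊎∣ p-prime (+ toℕ s - + toℕ r) (horner (syntheticDivision (+ toℕ r) f) (+ toℕ s))
             (∣m+n∣n⇒∣m (subst (+ p ∣_) (factor-theorem (+ toℕ r) f (+ toℕ s)) f[s]) f[r])
    ... | inj₁ p∣s-r = contradiction (sym (∣-difference⇒≡ s r p∣s-r)) r≢s
    ... | inj₂ p∣q   = p∣q

    lagrange : ∀ {n} (f : Vector ℤ n) (rs : List (Fin p)) → Unique rs → n ≤ length rs →
      All (Root f) rs → ∀ i → + p ∣ f i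
    lagrange {suc n} f (r ∷ rs) (r∉rs ∷ rs-unique) (s≤s n≤∣rs∣) (f[r] ∷ f[rs]) =
      ∣-coefficients (+ toℕ r) f f[r]
        (lagrange (syntheticDivision (+ toℕ r) f) rs rs-unique n≤∣rs∣
          (All.zipWith (λ (r≢s , f[s]) → root-of-quotient f r≢s f[r] f[s]) (r∉rs , f[rs])))

  ∑≡sum : ∀ n (f : Fin n → ℤ) → ∑ n f ≡ sum f
  ∑≡sum zero    f = refl
  ∑≡sum (suc n) f = cong (λ s → f zero + s) (∑≡sum n (λ i → f (suc i)))

  horner≡sum : ∀ {n} (f : Vector ℤ n) x → horner f x ≡ sum (λ i → f i * x ^ toℕ i)
  horner≡sum {zero}  f x = refl
  horner≡sum {suc n} f x = cong₂ _+_ (sym (ℤ.*-identityʳ (f zero))) (begin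
    x * horner (λ i → f (suc i)) x               ≡⟨ cong (x *_) (horner≡sum (λ i → f (suc i)) x) ⟩
    x * sum (λ i → f (suc i) * x ^ toℕ i)        ≡⟨ *-distribˡ-sum {n} x _ ⟩
    sum (λ i → x * (f (suc i) * x ^ toℕ i))      ≡⟨ sum-cong-≗ {n} (λ i → shift x (f (suc i)) (x ^ toℕ i)) ⟩
    sum (λ i → f (suc i) * (x * x ^ toℕ i))      ∎)
    where
    open ≡-Reasoning
    shift : ∀ x a y → x * (a * y) ≡ a * (x * y)
    shift = solve-∀

  evalℤ≡horner : ∀ {d e} (c : Expr d e) a x → evalℤ c a x ≡ horner (λ i → horner (c i) x) a
  evalℤ≡horner {d} {e} c a x = begin
    ∑ d (λ i → ∑ e (λ j → c i j * a ^ toℕ i * x ^ toℕ j))   ≡⟨ ∑≡sum d _ ⟩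
    sum (λ i → ∑ e (λ j → c i j * a ^ toℕ i * x ^ toℕ j))   ≡⟨ sum-cong-≗ {d} row ⟩
    sum (λ i → horner (c i) x * a ^ toℕ i)                  ≡⟨ horner≡sum (λ i → horner (c i) x) a ⟨
    horner (λ i → horner (c i) x) a                         ∎
    where
    open ≡-Reasoning
    swap : ∀ c y z → c * y * z ≡ c * z * y
    swap = solve-∀
    row : ∀ i → ∑ e (λ j → c i j * a ^ toℕ i * x ^ toℕ j) ≡ horner (c i) x * a ^ toℕ i
    row i = begin
      ∑ e (λ j → c i j * a ^ toℕ i * x ^ toℕ j)   ≡⟨ ∑≡sum e _ ⟩
      sum (λ j → c i j * a ^ toℕ i * x ^ toℕ j)   ≡⟨ sum-cong-≗ {e} (λ j → swap (c i j) (a ^ toℕ i) (x ^ toℕ j)) ⟩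
      sum (λ j → c i j * x ^ toℕ j * a ^ toℕ i)   ≡⟨ *-distribʳ-sum {e} (a ^ toℕ i) _ ⟨
      sum (λ j → c i j * x ^ toℕ j) * a ^ toℕ i   ≡⟨ cong (_* a ^ toℕ i) (horner≡sum (c i) x) ⟨
      horner (c i) x * a ^ toℕ i                  ∎

module Arithmetic where

  open import Data.Nat using (zero; suc; z≤n; s≤s; _+_; _*_; _^_; _≤_; _<_; _!; NonZero; nonTrivial⇒≢1)
  open import Data.Nat.Properties
  open import Data.Nat.Tactic.RingSolver using (solve-∀)
  open import Data.Nat.Divisibility using (_∣_; ∣-trans; ∣1⇒≡1; ∣m+n∣m⇒∣n; m∣m*n; m≤n⇒m!∣n!)
  open import Data.Nat.Primality using (Prime; prime⇒nonTrivial; prime⇒nonZero)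
  open import Data.Nat.Primality.Factorisation using (factorise)
  open import Data.List using ([]; _∷_)
  open import Data.Nat.ListAction using (product)
  open import Data.List.Relation.Unary.All using (_∷_)
  open import Data.Product using (∃-syntax; _×_; _,_)
  open import Relation.Nullary using (yes; no; contradiction)
  open import Relation.Binary.PropositionalEquality

  bernoulli : ∀ x m → x ^ suc m + suc m * x ^ m ≤ suc x ^ suc m
  bernoulli x zero    = ≤-reflexive (base x)
    where base : ∀ x → x * 1 + 1 * 1 ≡ suc x * 1
          base = solve-∀
  bernoulli x (suc m) = begin
    x ^ suc (suc m) + suc (suc m) * x ^ suc m                    ≤⟨ m≤m+n _ (suc m * x ^ m) ⟩
    x ^ suc (suc m) + suc (suc m) * x ^ suc m + suc m * x ^ m    ≡⟨ expand x m (x ^ m) ⟩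
    suc x * (x ^ suc m + suc m * x ^ m)                          ≤⟨ *-monoʳ-≤ (suc x) (bernoulli x m) ⟩
    suc x ^ suc (suc m)                                          ∎
    where
    open ≤-Reasoning
    expand : ∀ x m y → x * (x * y) + suc (suc m) * (x * y) + suc m * y ≡ suc x * (x * y + suc m * y)
    expand = solve-∀

  2*n^[1+n]≤[1+n]^[1+n] : ∀ n → 2 * n ^ suc n ≤ suc n ^ suc n
  2*n^[1+n]≤[1+n]^[1+n] n = begin
    2 * n ^ suc n                ≡⟨ cong (n ^ suc n +_) (+-identityʳ _) ⟩
    n ^ suc n + n * n ^ n        ≤⟨ +-monoʳ-≤ (n ^ suc n) (*-monoˡ-≤ (n ^ n) (n≤1+n n)) ⟩
    n ^ suc n + suc n * n ^ n    ≤⟨ bernoulli n n ⟩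
    suc n ^ suc n                ∎
    where open ≤-Reasoning

  exponential-decay : ∀ n s → 2 ^ s * n ^ (suc n * s) ≤ suc n ^ (suc n * s)
  exponential-decay n zero    rewrite *-zeroʳ n = ≤-refl
  exponential-decay n (suc s) = begin
    2 ^ suc s * n ^ (N * suc s)           ≡⟨ cong (λ e → 2 ^ suc s * n ^ e) (*-suc N s) ⟩
    2 ^ suc s * n ^ (N + N * s)           ≡⟨ cong (2 ^ suc s *_) (^-distribˡ-+-* n N (N * s)) ⟩
    (2 * 2 ^ s) * (n ^ N * n ^ (N * s))   ≡⟨ interchange 2 (2 ^ s) (n ^ N) (n ^ (N * s)) ⟩
    (2 * n ^ N) * (2 ^ s * n ^ (N * s))   ≤⟨ *-mono-≤ (2*n^[1+n]≤[1+n]^[1+n] n) (exponential-decay n s) ⟩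
    N ^ N * N ^ (N * s)                   ≡⟨ ^-distribˡ-+-* N N (N * s) ⟨
    N ^ (N + N * s)                       ≡⟨ cong (N ^_) (*-suc N s) ⟨
    N ^ (N * suc s)                       ∎
    where
    open ≤-Reasoning
    N = suc n
    interchange : ∀ a b c d → (a * b) * (c * d) ≡ (a * c) * (b * d)
    interchange = solve-∀

  [4+j]^2≤2^[4+j] : ∀ j → (4 + j) * (4 + j) ≤ 2 ^ (4 + j)
  [4+j]^2≤2^[4+j] zero    = ≤-refl
  [4+j]^2≤2^[4+j] (suc j) = begin
    suc n * suc n         ≡⟨ expand n ⟩
    n * n + (2 * n + 1)   ≤⟨ +-monoʳ-≤ (n * n) 2n+1≤n*n ⟩
    n * n + n * n         ≡⟨ cong (n * n +_) (+-identityʳ (n * n)) ⟨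
    2 * (n * n)           ≤⟨ *-monoʳ-≤ 2 ([4+j]^2≤2^[4+j] j) ⟩
    2 * 2 ^ n             ∎
    where
    open ≤-Reasoning
    n = 4 + j
    expand : ∀ n → suc n * suc n ≡ n * n + (2 * n + 1)
    expand = solve-∀
    double : ∀ n → 2 * n + 2 * n ≡ 4 * n
    double = solve-∀
    2n+1≤n*n : 2 * n + 1 ≤ n * n
    2n+1≤n*n = begin
      2 * n + 1       ≤⟨ +-monoʳ-≤ (2 * n) (s≤s z≤n) ⟩
      2 * n + 2 * n   ≡⟨ double n ⟩
      4 * n           ≤⟨ *-monoˡ-≤ n (m≤m+n 4 j) ⟩
      n * n           ∎

  linear≤2^ : ∀ A C → ∃[ K ] ∀ k → K ≤ k → A * k + C ≤ 2 ^ k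
  linear≤2^ A C = A + C + 4 , bound
    where
    bound : ∀ k → A + C + 4 ≤ k → A * k + C ≤ 2 ^ k
    bound k K≤k with m≤n⇒∃[o]m+o≡n (≤-trans (m≤n+m 4 (A + C)) K≤k)
    ... | j , refl = begin
      A * k + C         ≤⟨ +-monoʳ-≤ (A * k) (m≤m*n C k) ⟩
      A * k + C * k     ≡⟨ *-distribʳ-+ k A C ⟨
      (A + C) * k       ≤⟨ *-monoˡ-≤ k (≤-trans (m≤m+n (A + C) 4) K≤k) ⟩
      k * k             ≤⟨ [4+j]^2≤2^[4+j] j ⟩
      2 ^ k             ∎
      where open ≤-Reasoning

  n<2^n : ∀ n → n < 2 ^ n
  n<2^n zero    = s≤s z≤n
  n<2^n (suc n) = begin-strict
    suc n            <⟨ s≤s (n<2^n n) ⟩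
    1 + 2 ^ n        ≤⟨ +-monoˡ-≤ (2 ^ n) (m^n>0 2 n) ⟩
    2 ^ n + 2 ^ n    ≡⟨ cong (2 ^ n +_) (+-identityʳ (2 ^ n)) ⟨
    2 * 2 ^ n        ∎
    where open ≤-Reasoning

  binary-length : ∀ n → 1 ≤ n → ∃[ k ] (2 ^ k ≤ n × n < 2 ^ suc k)
  binary-length n 1≤n = search n (n<2^n n)
    where
    search : ∀ m → n < 2 ^ m → ∃[ k ] (2 ^ k ≤ n × n < 2 ^ suc k)
    search zero    n<1       = contradiction 1≤n (<⇒≱ n<1)
    search (suc m) n<2^[1+m] with n <? 2 ^ m
    ... | yes n<2^m = search m n<2^m
    ... | no  n≮2^m = m , ≮⇒≥ n≮2^m , n<2^[1+m]

  logarithmic-budget : ∀ A C → ∃[ N ] ∀ P → N ≤ P → ∃[ s ] (P < 2 ^ s × A * s + C ≤ P)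
  logarithmic-budget A C with linear≤2^ A (A + C)
  ... | K , eventually = 2 ^ K , budget
    where
    budget : ∀ P → 2 ^ K ≤ P → ∃[ s ] (P < 2 ^ s × A * s + C ≤ P)
    budget P 2^K≤P with binary-length P (≤-trans (m^n>0 2 K) 2^K≤P)
    ... | k , 2^k≤P , P<2^[1+k] = suc k , P<2^[1+k] , (begin
      A * suc k + C      ≡⟨ regroup A k C ⟩
      A * k + (A + C)    ≤⟨ eventually k K≤k ⟩
      2 ^ k              ≤⟨ 2^k≤P ⟩
      P                  ∎)
      where
      open ≤-Reasoning
      regroup : ∀ A k C → A * suc k + C ≡ A * k + (A + C)
      regroup = solve-∀
      K≤k : K ≤ k
      K≤k = ≮⇒≥ (λ k<K → <⇒≱ P<2^[1+k] (≤-trans (^-monoʳ-≤ 2 k<K) 2^K≤P))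

  n∣n! : ∀ n .{{_ : NonZero n}} → n ∣ n !
  n∣n! (suc n) = m∣m*n (n !)

  prime> : ∀ N → ∃[ p ] (Prime p × N < p)
  prime> N with factorise (suc (N !))
  ... | record { factors = [] ; isFactorisation = N!+1≡1 } =
    contradiction (subst (1 ≤_) (suc-injective N!+1≡1) (1≤n! N)) λ ()
  ... | record { factors = p ∷ ps ; isFactorisation = N!+1≡p*ps ; factorsPrime = p-prime ∷ _ } =
    p , p-prime , ≰⇒> (λ p≤N → nonTrivial⇒≢1 (∣1⇒≡1 (∣m+n∣m⇒∣n p∣N!+1 (p≤N⇒p∣N! p≤N))))
    where
    instance
      _ = prime⇒nonTrivial p-prime
      _ = prime⇒nonZero p-prime
    p∣N!+1 : p ∣ N ! + 1
    p∣N!+1 = subst (p ∣_) (trans (sym N!+1≡p*ps) (+-comm 1 (N !))) (m∣m*n (product ps))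
    p≤N⇒p∣N! : p ≤ N → p ∣ N !
    p≤N⇒p∣N! p≤N = ∣-trans (n∣n! p) (m≤n⇒m!∣n! p≤N)

module Counting where

  open Arithmetic using (exponential-decay)

  open import Data.Nat using (ℕ; zero; suc; z≤n; s≤s; _+_; _*_; _^_; _≤_; _<_; NonZero)
  open import Data.Nat.Properties
  import Algebra.Properties.Semiring.Sum as SemiringSum
  open import Data.Bool using (true; false; if_then_else_)
  open import Data.Fin using (Fin; toℕ; zero; suc)
  import Data.Fin.Properties as Fin
  open import Data.List using (List; []; _∷_; length; filter; tabulate; allFin; map; removeAt)
  open import Data.List.Properties using (length-removeAt′; length-map)
  open import Data.List.Membership.Propositional using (_∈_)
  open import Data.List.Relation.Unary.All as All using (All; []; _∷_)
  open import Data.List.Relation.Unary.All.Properties using (all-filter; filter⁺; filter⁻)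
  import Data.List.Relation.Unary.All.Properties as All
  open import Data.List.Relation.Unary.Unique.Propositional using (Unique; []; _∷_)
  import Data.List.Relation.Unary.Unique.Propositional.Properties as Unique
  open import Data.List.Relation.Unary.Any using (Any; here; there; index; any?; satisfied)
  open import Data.Product using (∃-syntax; _×_; _,_)
  import Data.Product as Product
  open import Function using (_∘_; id)
  open import Relation.Nullary using (Dec; yes; no; does; ¬_; ¬?; contradiction)
  open import Relation.Unary using (Pred; Decidable)
  open import Relation.Binary.PropositionalEquality

  open SemiringSum +-*-semiring using (sum; sum-cong-≗; ∑-comm; ∑-distrib-+; sum-replicate-zero)

  indicator : ∀ {a} {A : Set a} → Dec A → ℕ
  indicator a? = if does a? then 1 else 0

  indicator-no : ∀ {a} {A : Set a} (a? : Dec A) → ¬ A → indicator a? ≡ 0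
  indicator-no (yes a) ¬a = contradiction a ¬a
  indicator-no (no _)  _  = refl

  length-filter-tabulate : ∀ {A : Set} {ℓ} {P : Pred A ℓ} (P? : Decidable P) {n} (f : Fin n → A) →
    length (filter P? (tabulate f)) ≡ sum (λ i → indicator (P? (f i)))
  length-filter-tabulate P? {zero}  f = refl
  length-filter-tabulate P? {suc n} f with does (P? (f zero))
  ... | true  = cong suc (length-filter-tabulate P? (f ∘ suc))
  ... | false = length-filter-tabulate P? (f ∘ suc)

  length-filter-∁ : ∀ {A : Set} {ℓ} {P : Pred A ℓ} (P? : Decidable P) (xs : List A) →
    length (filter P? xs) + length (filter (¬? ∘ P?) xs) ≡ length xs
  length-filter-∁ P? []       = refl
  length-filter-∁ P? (x ∷ xs) with P? x
  ... | yes _ = cong suc (length-filter-∁ P? xs)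
  ... | no  _ = trans (+-suc _ _) (cong suc (length-filter-∁ P? xs))

  sum-const-1 : ∀ n → sum {n} (λ _ → 1) ≡ n
  sum-const-1 zero    = refl
  sum-const-1 (suc n) = cong suc (sum-const-1 n)

  sum-indicator-≟ : ∀ {n} w → w < n → sum {n} (λ v → indicator (w ≟ toℕ v)) ≡ 1
  sum-indicator-≟ {suc n} zero    _         = cong suc (sum-replicate-zero n)
  sum-indicator-≟ {suc n} (suc w) (s≤s w<n) = sum-indicator-≟ w w<n

  pigeonhole-sum : ∀ {n} .{{_ : NonZero n}} (w : Fin n → ℕ) K → K * n ≤ sum w → ∃[ v ] K ≤ w v
  pigeonhole-sum {suc _} w K Kn≤∑w with K ≤? w zero
  ... | yes K≤w₀ = zero , K≤w₀
  pigeonhole-sum {1} w K K≤∑w | no K≰w₀ =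
    contradiction (subst₂ _≤_ (*-identityʳ K) (+-identityʳ (w zero)) K≤∑w) K≰w₀
  pigeonhole-sum {suc (suc n)} w K Kn≤∑w | no K≰w₀ =
    Product.map suc id (pigeonhole-sum (w ∘ suc) K (+-cancelˡ-≤ K _ _ (begin
      K + K * suc n          ≡⟨ *-suc K (suc n) ⟨
      K * suc (suc n)        ≤⟨ Kn≤∑w ⟩
      w zero + sum (w ∘ suc) ≤⟨ +-monoˡ-≤ _ (<⇒≤ (≰⇒> K≰w₀)) ⟩
      K + sum (w ∘ suc)      ∎)))
    where open ≤-Reasoning

  shrink-invariant : ∀ D r L t → suc D * r ≤ D * L → L * D ^ suc t < suc D ^ suc t → r * D ^ t < suc D ^ t
  shrink-invariant D r L t Dr≤DL small = *-cancelˡ-< (suc D) _ _ (begin-strict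
    suc D * (r * D ^ t)   ≡⟨ *-assoc (suc D) r (D ^ t) ⟨
    suc D * r * D ^ t     ≤⟨ *-monoˡ-≤ (D ^ t) Dr≤DL ⟩
    D * L * D ^ t         ≡⟨ cong (_* D ^ t) (*-comm D L) ⟩
    L * D * D ^ t         ≡⟨ *-assoc L D (D ^ t) ⟩
    L * D ^ suc t         <⟨ small ⟩
    suc D ^ suc t         ∎)
    where open ≤-Reasoning

  ∈-removeAt : ∀ {A : Set} {x y : A} {ys : List A} (x∈ys : x ∈ ys) → y ∈ ys → y ≢ x →
    y ∈ removeAt ys (index x∈ys)
  ∈-removeAt (here refl) (here refl)  y≢x = contradiction refl y≢x
  ∈-removeAt (here _)    (there y∈ys) _   = y∈ys
  ∈-removeAt (there _)   (here y≡z)   _   = here y≡z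
  ∈-removeAt (there x∈ys) (there y∈ys) y≢x = there (∈-removeAt x∈ys y∈ys y≢x)

  unique-⊆⇒length≤ : ∀ {A : Set} {xs ys : List A} → Unique xs → All (_∈ ys) xs → length xs ≤ length ys
  unique-⊆⇒length≤ [] [] = z≤n
  unique-⊆⇒length≤ {ys = ys} (x∉xs ∷ xs-unique) (x∈ys ∷ xs⊆ys) =
    subst (_ ≤_) (sym (length-removeAt′ ys (index x∈ys)))
      (s≤s (unique-⊆⇒length≤ xs-unique
        (All.zipWith (λ (x≢y , y∈ys) → ∈-removeAt x∈ys y∈ys (x≢y ∘ sym)) (x∉xs , xs⊆ys))))

  ∣image∣≤ : ∀ {q} (f : Fin q → ℕ) (T : List ℕ) → (∀ x → f x ∈ T) →
    length (filter (λ y → any? (λ x → f x ≟ toℕ y) (allFin q)) (allFin q)) ≤ length T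
  ∣image∣≤ {q} f T image⊆T = subst (_≤ length T) (length-map toℕ ys)
    (unique-⊆⇒length≤ (Unique.map⁺ Fin.toℕ-injective (Unique.filter⁺ _ (Unique.allFin⁺ q)))
                      (All.map⁺ (All.map value∈T (all-filter _ (allFin q)))))
    where
    ys = filter (λ y → any? (λ x → f x ≟ toℕ y) (allFin q)) (allFin q)
    value∈T : ∀ {y} → Any (λ x → f x ≡ toℕ y) (allFin q) → toℕ y ∈ T
    value∈T hit with satisfied hit
    ... | x , fx≡y = subst (_∈ T) fx≡y (image⊆T x)

  module Covering {X : Set} {n : ℕ} .{{_ : NonZero n}} (g : Fin n → X → ℕ) (g<n : ∀ a x → g a x < n) where

    fibre : X → Fin n → ℕ
    fibre x v = sum {n} (λ a → indicator (g a x ≟ toℕ v))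

    Hit : Fin n → X → Set
    Hit v x = ∃[ a ] g a x ≡ toℕ v

    hit? : ∀ v → Decidable (Hit v)
    hit? v x = Fin.any? (λ a → g a x ≟ toℕ v)

    Covered : List ℕ → X → Set
    Covered S x = ∃[ a ] g a x ∈ S

    FibresBoundedBy : ℕ → X → Set
    FibresBoundedBy D x = ∀ v → fibre x v ≤ D

    sum-fibre : ∀ x → sum {n} (fibre x) ≡ n
    sum-fibre x = begin
      sum {n} (λ v → sum {n} (λ a → indicator (g a x ≟ toℕ v)))
        ≡⟨ ∑-comm {n} {n} (λ v a → indicator (g a x ≟ toℕ v)) ⟩
      sum {n} (λ a → sum {n} (λ v → indicator (g a x ≟ toℕ v)))
        ≡⟨ sum-cong-≗ {n} (λ a → sum-indicator-≟ (g a x) (g<n a x)) ⟩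
      sum {n} (λ _ → 1)
        ≡⟨ sum-const-1 n ⟩
      n ∎
      where open ≡-Reasoning

    fibre-miss : ∀ {v x} → ¬ Hit v x → fibre x v ≡ 0
    fibre-miss {v} {x} miss =
      trans (sum-cong-≗ {n} (λ a → indicator-no (g a x ≟ toℕ v) (λ ga≡v → miss (a , ga≡v))))
            (sum-replicate-zero n)

    load : List X → Fin n → ℕ
    load []       v = 0
    load (x ∷ xs) v = fibre x v + load xs v

    sum-load : ∀ xs → sum {n} (load xs) ≡ length xs * n
    sum-load []       = sum-replicate-zero n
    sum-load (x ∷ xs) = trans (∑-distrib-+ {n} (fibre x) (load xs)) (cong₂ _+_ (sum-fibre x) (sum-load xs))

    load≤ : ∀ {D} v xs → All (FibresBoundedBy D) xs → load xs v ≤ D * length (filter (hit? v) xs)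
    load≤ v [] [] = z≤n
    load≤ {D} v (x ∷ xs) (x-bounded ∷ xs-bounded) with hit? v x
    ... | yes _   = ≤-trans (+-mono-≤ (x-bounded v) (load≤ v xs xs-bounded))
                              (≤-reflexive (sym (*-suc D _)))
    ... | no miss = ≤-trans (≤-reflexive (cong (_+ load xs v) (fibre-miss miss))) (load≤ v xs xs-bounded)

    heavy-value : ∀ xs → ∃[ v ] length xs ≤ load xs v
    heavy-value xs = pigeonhole-sum (load xs) (length xs) (≤-reflexive (sym (sum-load xs)))

    greedy-step : ∀ {D} xs → All (FibresBoundedBy (suc D)) xs →
      ∃[ v ] suc D * length (filter (¬? ∘ hit? v) xs) ≤ D * length xs
    greedy-step {D} xs bounded with heavy-value xs
    ... | v , L≤load = v , +-cancelʳ-≤ L _ _ (begin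
      suc D * r + L          ≤⟨ +-monoʳ-≤ _ (≤-trans L≤load (load≤ v xs bounded)) ⟩
      suc D * r + suc D * h  ≡⟨ *-distribˡ-+ (suc D) r h ⟨
      suc D * (r + h)        ≡⟨ cong (suc D *_) (trans (+-comm r h) (length-filter-∁ (hit? v) xs)) ⟩
      suc D * L              ≡⟨ +-comm L (D * L) ⟩
      D * L + L              ∎)
      where
      open ≤-Reasoning
      L = length xs
      h = length (filter (hit? v) xs)
      r = length (filter (¬? ∘ hit? v) xs)

    cover : ∀ {D} t xs → All (FibresBoundedBy (suc D)) xs → length xs * D ^ t < suc D ^ t →
      ∃[ S ] (length S ≤ t × All (Covered S) xs)
    cover zero    []       _ _               = [] , z≤n , []
    cover zero    (_ ∷ _)  _ (s≤s ())
    cover {D} (suc t) xs bounded small with greedy-step xs bounded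
    ... | v , shrinks
      with cover t (filter (¬? ∘ hit? v) xs) (filter⁺ _ bounded) (shrink-invariant D _ _ t shrinks small)
    ... | S , ∣S∣≤t , S-covers =
      toℕ v ∷ S , s≤s ∣S∣≤t ,
      filter⁻ (hit? v) (All.map (λ (a , ga≡v) → a , here ga≡v) (all-filter (hit? v) xs))
                       (All.map (λ (a , ga∈S) → a , there ga∈S) S-covers)

    cover-logarithmic : ∀ {D} s xs → All (FibresBoundedBy (suc D)) xs → length xs < 2 ^ s →
      ∃[ S ] (length S ≤ suc D * s × All (Covered S) xs)
    cover-logarithmic {D} s xs bounded xs<2^s =
      cover (suc D * s) xs bounded (<-*-≤ (D ^ (suc D * s)) xs<2^s (exponential-decay D s) (m^n>0 (suc D) (suc D * s)))
      where
      <-*-≤ : ∀ {l m n} o → l < m → m * o ≤ n → 0 < n → l * o < n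
      <-*-≤ {l} {n = n} zero _ _ 0<n = subst (_< n) (sym (*-zeroʳ l)) 0<n
      <-*-≤     (suc o) l<m m*o≤n _   = <-≤-trans (*-monoˡ-< (suc o) l<m) m*o≤n

module FewValues where

  open Polynomials
  open Arithmetic using (logarithmic-budget; prime>)
  open Counting

  open import Data.Nat using (ℕ; zero; suc; _+_; _*_; _^_; _≤_; _<_)
  open import Data.Nat.Properties
  open import Data.Nat.Tactic.RingSolver using (solve-∀)
  open import Data.Nat.Primality using (Prime; prime⇒nonZero)
  open import Data.Integer as ℤ using (ℤ; +_; 0ℤ; _-_)
  import Data.Integer.Properties as ℤ
  open import Data.Integer.Divisibility.Signed using (_∣_; _∣?_; ∣⇒∣ᵤ)
  open import Data.Fin using (Fin; toℕ; zero; suc)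
  open import Data.Vec.Functional using (updateAt)
  open import Data.List using (List; []; _∷_; length; filter; allFin; map; _++_)
  import Data.List.Properties as List
  open import Data.List.Membership.Propositional using (_∈_)
  open import Data.List.Membership.Propositional.Properties
    using (∈-filter⁺; ∈-allFin; ∈-map⁺; ∈-++⁺ˡ; ∈-++⁺ʳ)
  open import Data.List.Relation.Unary.All as All using (All; []; _∷_)
  open import Data.List.Relation.Unary.All.Properties using (all-filter)
  open import Data.List.Relation.Unary.AllPairs using ([]; _∷_)
  import Data.List.Relation.Unary.Unique.Propositional.Properties as Unique
  open import Data.Product using (∃-syntax; Σ; _×_; _,_; proj₁; proj₂)
  import Data.Product as Product
  open import Function using (_∘_)
  open import Relation.Nullary using (¬_; yes; no; ¬?)
  open import Relation.Unary using (Decidable)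
  open import Relation.Binary.PropositionalEquality

  prime⇒squarefreeAbove : ∀ {M p} → Prime p → M < p → SquarefreeAbove M p
  prime⇒squarefreeAbove {p = p} p-prime M<p = p ∷ [] , [] ∷ [] , (p-prime , M<p) ∷ [] , sym (*-identityʳ p)

  module AtPrime {Dm e : ℕ} (c : Expr (2 + Dm) e) (k : Fin (suc Dm)) (j : Fin e) (c≢0 : c (suc k) j ≢ 0ℤ)
                   {P : ℕ} (P-prime : Prime P) (∣c∣<P : ℤ.∣ c (suc k) j ∣ < P) where

    instance _ = prime⇒nonZero P-prime

    row : Fin (2 + Dm) → ℤ → ℤ
    row i = horner (c i)

    value : Fin P → Fin P → ℕ
    value a x = reduce P (evalℤ c (+ toℕ a) (+ toℕ x))

    open Covering value (λ a x → reduce< P _)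

    Bad : Fin P → Set
    Bad x = + P ∣ row (suc k) (+ toℕ x)

    bad? : Decidable Bad
    bad? x = + P ∣? row (suc k) (+ toℕ x)

    badPoints goodPoints : List (Fin P)
    badPoints  = filter bad? (allFin P)
    goodPoints = filter (¬? ∘ bad?) (allFin P)

    few-bad : length badPoints < e
    few-bad = ≰⇒> λ e≤∣bad∣ → P∤c (lagrange P-prime (c (suc k)) badPoints
      (Unique.filter⁺ bad? (Unique.allFin⁺ P)) e≤∣bad∣ (all-filter bad? (allFin P)) j)
      where
      P∤c : ¬ + P ∣ c (suc k) j
      P∤c P∣c = c≢0 (ℤ.∣i∣≡0⇒i≡0 (∣∧<⇒≡0 (∣⇒∣ᵤ P∣c) ∣c∣<P))

    fibre-bound : ∀ x → ¬ Bad x → FibresBoundedBy (suc Dm) x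
    fibre-bound x good v = ≮⇒≥ λ many → good
      (lagrange P-prime f roots (Unique.filter⁺ _ (Unique.allFin⁺ P))
        (subst (2 + Dm ≤_) (sym (length-filter-tabulate (λ a → value a x ≟ toℕ v) {P} (λ a → a))) many)
        (All.map root (all-filter _ (allFin P))) (suc k))
      where
      f = updateAt (λ i → row i (+ toℕ x)) zero (_- + toℕ v)
      roots = filter (λ a → value a x ≟ toℕ v) (allFin P)
      root : ∀ {a} → value a x ≡ toℕ v → Root f a
      root {a} eq = subst (+ P ∣_)
        (trans (cong₂ _-_ (evalℤ≡horner c (+ toℕ a) (+ toℕ x)) (cong +_ eq))
               (sym (horner-updateAt-zero (λ i → row i (+ toℕ x)) (+ toℕ v) (+ toℕ a))))
        (∣-reduce P (evalℤ c (+ toℕ a) (+ toℕ x)))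

    ∣good∣≤P : length goodPoints ≤ P
    ∣good∣≤P = ≤-trans (List.length-filter (¬? ∘ bad?) (allFin P)) (≤-reflexive (List.length-tabulate (λ a → a)))

    good-bounded : All (FibresBoundedBy (suc Dm)) goodPoints
    good-bounded = All.map (fibre-bound _) (all-filter (¬? ∘ bad?) (allFin P))

    badValues : List ℕ
    badValues = map (λ y → value y y) badPoints

    covering-choice : ∀ {S} → All (Covered S) goodPoints → ∀ x → ∃[ a ] value a x ∈ S ++ badValues
    covering-choice {S} S-covers x with bad? x
    ... | yes bad  = x , ∈-++⁺ʳ S (∈-map⁺ _ (∈-filter⁺ bad? (∈-allFin x) bad))
    ... | no  good = Product.map₂ ∈-++⁺ˡ (All.lookup S-covers (∈-filter⁺ (¬? ∘ bad?) (∈-allFin x) good))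

    few-values-from-cover : ∀ {t} S → length S ≤ t → All (Covered S) goodPoints →
      ∃[ α ] numValues c P α ≤ t + e
    few-values-from-cover {t} S ∣S∣≤t S-covers = α , (begin
      numValues c P α                ≤⟨ ∣image∣≤ (evalMod c P α) _ (proj₂ ∘ covering-choice S-covers) ⟩
      length (S ++ badValues)        ≡⟨ List.length-++ S ⟩
      length S + length badValues    ≡⟨ cong (λ n → length S + n) (List.length-map _ badPoints) ⟩
      length S + length badPoints    ≤⟨ +-mono-≤ ∣S∣≤t (<⇒≤ few-bad) ⟩
      t + e                          ∎)
      where
      open ≤-Reasoning
      α = proj₁ ∘ covering-choice S-covers

    few-values : ∀ s → P < 2 ^ s → ∃[ α ] numValues c P α ≤ suc Dm * s + e
    few-values s P<2^s =
      let S , ∣S∣≤Ds , S-covers = cover-logarithmic s goodPoints good-bounded (≤-<-trans ∣good∣≤P P<2^s)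
      in  few-values-from-cover S ∣S∣≤Ds S-covers

  few-values-mod-large-prime : ∀ {Dm e} (c : Expr (2 + Dm) e) k j → c (suc k) j ≢ 0ℤ → ∀ m M →
    ∃[ P ] (Prime P × M < P × Σ (Fin P → Fin P) λ α → m * numValues c P α ≤ P)
  few-values-mod-large-prime {Dm} {e} c k j c≢0 m M =
    let N , budget              = logarithmic-budget (m * suc Dm) (m * e)
        P , P-prime , M+∣c∣+N<P = prime> (M + ℤ.∣ c (suc k) j ∣ + N)
        M<P , ∣c∣<P , N≤P       = split M+∣c∣+N<P
        s , P<2^s , m[Ds+e]≤P   = budget P N≤P
        α , few                 = AtPrime.few-values c k j c≢0 P-prime ∣c∣<P s P<2^s
    in  P , P-prime , M<P , α , ≤-trans (*-monoʳ-≤ m few) (subst (_≤ P) (sym (distrib m (suc Dm) s e)) m[Ds+e]≤P)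
    where
    distrib : ∀ m D s e → m * (D * s + e) ≡ m * D * s + m * e
    distrib = solve-∀
    split : ∀ {x y z w} → x + y + z < w → x < w × y < w × z ≤ w
    split {x} {y} {z} x+y+z<w =
      ≤-<-trans (≤-trans (m≤m+n x y) (m≤m+n _ z)) x+y+z<w ,
      ≤-<-trans (≤-trans (m≤n+m y x) (m≤m+n _ z)) x+y+z<w ,
      ≤-trans (m≤n+m z (x + y)) (<⇒≤ x+y+z<w)

open import Data.Nat using (ℕ; _>_)
open import Data.Integer using (ℤ; 0ℤ; +_)
open import Data.Fin using (Fin; toℕ)
open import Data.Product using (_×_; Σ; ∃-syntax)
open import Data.Rational using (ℚ; Positive; _≤_; _*_; _/_)
open import Relation.Binary.PropositionalEquality using (_≢_)

open import Data.Nat as ℕ using (zero; suc)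
import Data.Nat.Properties as ℕ
open import Data.Nat.Coprimality as Coprimality using (1-coprimeTo)
open import Data.Integer as ℤ using (+[1+_])
import Data.Integer.Properties as ℤ
open import Data.Fin using (zero; suc)
open import Data.Product using (_,_)
open import Data.Rational using (mkℚ; ↧ₙ_; toℚᵘ)
open import Data.Rational.Properties using (normalize-coprime; toℚᵘ-cancel-≤; toℚᵘ-homo-*)
import Data.Rational.Unnormalised as ℚᵘ
import Data.Rational.Unnormalised.Properties as ℚᵘ
open import Relation.Binary.PropositionalEquality using (_≡_; sym; trans; cong; subst₂)
open FewValues using (prime⇒squarefreeAbove; few-values-mod-large-prime)

n/1≡mkℚ : ∀ n → (+ n) / 1 ≡ mkℚ (+ n) 0 (Coprimality.sym (1-coprimeTo n))
n/1≡mkℚ n = normalize-coprime (Coprimality.sym (1-coprimeTo n))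

-- ε ≥ 1/↧ε since ↥ε ≥ 1
↧ε*K≤P⇒K≤ε*P : ∀ ε → Positive ε → ∀ K P → ↧ₙ ε ℕ.* K ℕ.≤ P → (+ K) / 1 ≤ ε * ((+ P) / 1)
↧ε*K≤P⇒K≤ε*P ε@(mkℚ +[1+ a ] b _) _ K P [1+b]K≤P rewrite n/1≡mkℚ K | n/1≡mkℚ P =
  toℚᵘ-cancel-≤ (ℚᵘ.≤-respʳ-≃ (ℚᵘ.≃-sym (toℚᵘ-homo-* ε P/1))
    (ℚᵘ.*≤* (subst₂ ℤ._≤_ lhs rhs (ℤ.+≤+ bound))))
  where
  P/1 = mkℚ (+ P) 0 (Coprimality.sym (1-coprimeTo P))
  lhs : + (K ℕ.* suc (b ℕ.* 1)) ≡ + K ℤ.* + suc (b ℕ.* 1)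
  lhs = ℤ.pos-* K (suc (b ℕ.* 1))
  rhs : + (suc a ℕ.* P ℕ.* 1) ≡ (+[1+ a ] ℤ.* + P) ℤ.* + 1
  rhs = trans (ℤ.pos-* (suc a ℕ.* P) 1) (cong (ℤ._* + 1) (ℤ.pos-* (suc a) P))
  bound : K ℕ.* suc (b ℕ.* 1) ℕ.≤ suc a ℕ.* P ℕ.* 1
  bound = begin
    K ℕ.* suc (b ℕ.* 1)   ≡⟨ cong (λ d → K ℕ.* suc d) (ℕ.*-identityʳ b) ⟩
    K ℕ.* suc b           ≡⟨ ℕ.*-comm K (suc b) ⟩
    suc b ℕ.* K           ≤⟨ [1+b]K≤P ⟩
    P                     ≤⟨ ℕ.m≤n*m P (suc a) ⟩
    suc a ℕ.* P           ≡⟨ ℕ.*-identityʳ _ ⟨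
    suc a ℕ.* P ℕ.* 1     ∎
    where open ℕ.≤-Reasoning

corollary1 : ∀ {d e} (c : Expr d e) →
    (∃[ i ] ∃[ j ] (toℕ i > 0 × c i j ≢ 0ℤ)) →
    (ε : ℚ) → Positive ε → (M : ℕ) →
    ∃[ q ] (SquarefreeAbove M q × Σ (Fin q → Fin q) λ α →
    (+ numValues c q α) / 1 ≤ ε * ((+ q) / 1))
corollary1 {suc zero}    c (zero  , _ , () , _)
corollary1 {suc (suc _)} c (zero  , _ , () , _)
corollary1 {suc (suc _)} c (suc k , j , _ , c≢0) ε ε>0 M =
  let P , P-prime , M<P , α , few = few-values-mod-large-prime c k j c≢0 (↧ₙ ε) M
  in  P , prime⇒squarefreeAbove P-prime M<P , α , ↧ε*K≤P⇒K≤ε*P ε ε>0 _ P few
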